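{- For integers $d\geq 1$ and $k\geq -1$ define the polynomial \[ p_{d,k}(n)=3d\binom{n+k}{1+k}+\sum_{i=1}^{k}(3i+2)\binom{n-1+k-i}{k-i}. \] Then for all integers $d\geq 1$, $k\geq 1$, and $n\geq 0$, we have $p_{d,k}(n)\geq 3dn+3k+2$.
   Context: Binomial coefficients are interpreted as polynomials in the top argument: for an integer $j\geq 0$, $\binom{x}{j}=\frac{x(x-1)\cdots(x-j+1)}{j!}$ (so, e.g., $\binom{ -1}{0}=1$ and $\binom{k}{k+1}=0$ for integers $k\geq 0$). -}

module Defs where

open import Data.Nat as ℕ using (ℕ; zero; suc; _!)
open import Data.Nat.Properties using (_!≢0)
open import Data.Integer using (ℤ; +_; _+_; _-_; _*_)
open import Data.Integer.DivMod using (_/ℕ_)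

fall : ℤ → ℕ → ℤ
fall x zero    = + 1
fall x (suc j) = fall x j * (x - + j)

-- binomial coefficient as a polynomial in the top argument:
-- binom x j = x (x-1) ... (x-j+1) / j!  (the division is exact)
binom : ℤ → ℕ → ℤ
binom x j = _/ℕ_ (fall x j) (j !) {{j !≢0}}

sumFrom1 : ℕ → (ℕ → ℤ) → ℤ
sumFrom1 zero    f = + 0
sumFrom1 (suc k) f = sumFrom1 k f + f (suc k)

-- p_{d,k}(n) = 3d C(n+k, 1+k) + Σ_{i=1}^{k} (3i+2) C(n-1+k-i, k-i)
-- (for k ≥ 0; the bottom index k-i is a natural number for 1 ≤ i ≤ k)
p : ℕ → ℕ → ℤ → ℤ
p d k n = + (3 ℕ.* d) * binom (n + + k) (suc k)
        + sumFrom1 k (λ i → + (3 ℕ.* i ℕ.+ 2) * binom (n - + 1 + + k - + i) (k ℕ.∸ i))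

-- On n = m ≥ 0 every binomial coefficient in p is an ordinary one, hence
-- non-negative. The leading term is at least 3dm because C(m+k, 1+k) ≥ m,
-- and the last summand (i = k) is (3k+2) C(m-1, 0) = 3k+2; the other
-- summands are dropped.
module Submission where

open import Defs
open import Data.Nat as ℕ using (ℕ; zero; suc; z≤n; s≤s; _!)
open import Data.Nat.Combinatorics using (_C_; nCk≡nPk/k!; k>n⇒nCk≡0; nCk+nC[k+1]≡[n+1]C[k+1])
open import Data.Nat.Combinatorics.Base using (_P_; _P′_)
open import Data.Nat.DivMod using (0/n≡0)
import Data.Nat.Properties as ℕ
open import Data.Integer using (ℤ; +_; -_; _+_; _-_; _*_; _≤_; _≥_; +≤+)
import Data.Integer.Properties as ℤ
open import Data.Bool using (true)
open import Data.Sum using (inj₁; inj₂)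
open import Relation.Nullary using (yes; no)
open import Relation.Binary.PropositionalEquality

n<k⇒nP′k≡0 : ∀ {n k} → n ℕ.< k → n P′ k ≡ 0
n<k⇒nP′k≡0 {n} {suc k} (s≤s n≤k) with ℕ.m≤n⇒m<n∨m≡n n≤k
... | inj₁ n<k  rewrite n<k⇒nP′k≡0 n<k = ℕ.*-zeroʳ (n ℕ.∸ k)
... | inj₂ refl rewrite ℕ.n∸n≡0 n      = refl

k≤n⇒nPk≡nP′k : ∀ {n k} → k ℕ.≤ n → n P k ≡ n P′ k
k≤n⇒nPk≡nP′k {n} {k} k≤n with k ℕ.≤ᵇ n | ℕ.≤⇒≤ᵇ k≤n
... | true | _ = refl

0<[k+t]Ck : ∀ k t → 0 ℕ.< (k ℕ.+ t) C k
0<[k+t]Ck zero    t = s≤s z≤n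
0<[k+t]Ck (suc k) t rewrite sym (nCk+nC[k+1]≡[n+1]C[k+1] (k ℕ.+ t) k) =
  ℕ.≤-trans (0<[k+t]Ck k t) (ℕ.m≤m+n _ _)

m≤[m+k]C[1+k] : ∀ m k → m ℕ.≤ (m ℕ.+ k) C suc k
m≤[m+k]C[1+k] zero    k = z≤n
m≤[m+k]C[1+k] (suc m) k rewrite sym (nCk+nC[k+1]≡[n+1]C[k+1] (m ℕ.+ k) k) =
  ℕ.+-mono-≤ (subst (λ n → 0 ℕ.< n C k) (ℕ.+-comm k m) (0<[k+t]Ck k m))
             (m≤[m+k]C[1+k] m k)

fall-+ : ∀ n k → fall (+ n) k ≡ + (n P′ k)
fall-+ n zero    = refl
fall-+ n (suc k) with k ℕ.≤? n
... | yes k≤n = begin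
  fall (+ n) k * (+ n - + k)        ≡⟨ cong₂ _*_ (fall-+ n k) (trans (ℤ.m-n≡m⊖n n k) (ℤ.⊖-≥ k≤n)) ⟩
  + (n P′ k) * + (n ℕ.∸ k)          ≡⟨ sym (ℤ.pos-* (n P′ k) (n ℕ.∸ k)) ⟩
  + ((n P′ k) ℕ.* (n ℕ.∸ k))        ≡⟨ cong +_ (ℕ.*-comm (n P′ k) (n ℕ.∸ k)) ⟩
  + (n P′ suc k)                    ∎
  where open ≡-Reasoning
... | no k≰n
  rewrite fall-+ n k | n<k⇒nP′k≡0 (ℕ.≰⇒> k≰n) | ℕ.*-zeroʳ (n ℕ.∸ k) = ℤ.*-zeroˡ (+ n - + k)

binom-+ : ∀ n k → binom (+ n) k ≡ + (n C k)
binom-+ n k rewrite fall-+ n k with k ℕ.≤? n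
... | yes k≤n rewrite nCk≡nPk/k! k≤n | k≤n⇒nPk≡nP′k k≤n = refl
... | no k≰n rewrite n<k⇒nP′k≡0 (ℕ.≰⇒> k≰n) | k>n⇒nCk≡0 (ℕ.≰⇒> k≰n) =
  cong +_ (0/n≡0 (k !) {{k ℕ.!≢0}})

binom-nonNeg : ∀ {x} k → x ≥ + 0 → binom x k ≥ + 0
binom-nonNeg {+ n} k _ rewrite binom-+ n k = +≤+ z≤n

m≤binom[m+k][1+k] : ∀ m k → + m ≤ binom (+ m + + k) (suc k)
m≤binom[m+k][1+k] m k rewrite binom-+ (m ℕ.+ k) (suc k) = +≤+ (m≤[m+k]C[1+k] m k)

sumFrom1-nonNeg : ∀ k f → (∀ i → i ℕ.≤ k → f i ≥ + 0) → sumFrom1 k f ≥ + 0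
sumFrom1-nonNeg zero    f _   = +≤+ z≤n
sumFrom1-nonNeg (suc k) f f≥0 = ℤ.+-mono-≤ {+ 0} {_} {+ 0}
  (sumFrom1-nonNeg k f (λ i i≤k → f≥0 i (ℕ.m≤n⇒m≤1+n i≤k)))
  (f≥0 (suc k) ℕ.≤-refl)

lemma2 : (d k : ℕ) → 1 ℕ.≤ d → 1 ℕ.≤ k → (n : ℤ) → n ≥ + 0 →
           p d k n ≥ + 3 * + d * n + + (3 ℕ.* k) + + 2
lemma2 d (suc k) _ _ (+ m) _ = begin
  + 3 * + d * + m + + (3 ℕ.* suc k) + + 2
    ≡⟨ ℤ.+-assoc (+ 3 * + d * + m) (+ (3 ℕ.* suc k)) (+ 2) ⟩
  + 3 * + d * + m + + (3 ℕ.* suc k ℕ.+ 2)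
    ≡⟨ cong (_+ + (3 ℕ.* suc k ℕ.+ 2)) leading-coefficient ⟩
  + (3 ℕ.* d) * + m + (+ 0 + + (3 ℕ.* suc k ℕ.+ 2))
    ≤⟨ ℤ.+-mono-≤ (ℤ.*-monoˡ-≤-nonNeg (+ (3 ℕ.* d)) (m≤binom[m+k][1+k] m (suc k)))
                  (ℤ.+-mono-≤ (sumFrom1-nonNeg k summand summand-nonNeg) (ℤ.≤-reflexive (sym last-summand))) ⟩
  p d (suc k) (+ m) ∎
  where
  open ℤ.≤-Reasoning

  summand : ℕ → ℤ
  summand i = + (3 ℕ.* i ℕ.+ 2) * binom (+ m - + 1 + + suc k - + i) (suc k ℕ.∸ i)

  leading-coefficient : + 3 * + d * + m ≡ + (3 ℕ.* d) * + m
  leading-coefficient = cong (_* + m) (sym (ℤ.pos-* 3 d))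

  last-summand : summand (suc k) ≡ + (3 ℕ.* suc k ℕ.+ 2)
  last-summand rewrite ℕ.n∸n≡0 k = ℤ.*-identityʳ _

  summand-nonNeg : ∀ i → i ℕ.≤ k → summand i ≥ + 0
  summand-nonNeg i i≤k = subst (_≤ summand i) (ℤ.*-zeroʳ (+ (3 ℕ.* i ℕ.+ 2)))
    (ℤ.*-monoˡ-≤-nonNeg (+ (3 ℕ.* i ℕ.+ 2)) (binom-nonNeg (suc k ℕ.∸ i) (subst (λ x → x - + i ≥ + 0) (sym top)
      (ℤ.i≤j⇒0≤j-i (+≤+ (ℕ.≤-trans i≤k (ℕ.m≤n+m k m)))))))
    where
    top : + m - + 1 + + suc k ≡ + (m ℕ.+ k)
    top = ℤ.+-assoc (+ m) (- + 1) (+ suc k)
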